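{- Let $q\ge5$ be prime, $q^*=(-1)^{(q-1)/2}q$, $u_q(j)=(3^j-q^*(-1)^j)/4$, and let $D_q(n)$ be the smallest positive integer $m$ such that $u_q(1),\ldots,u_q(n)$ are pairwise incongruent modulo $m$. Then $n\le D_q(n)\le 2n-1$ for every $n\ge1$. -}

module Defs where

open import Data.Nat as ℕ using (ℕ; _≤_; _<_; _∸_)
open import Data.Integer as ℤ using (ℤ; +_; -_; _-_; _*_; _^_; _/ℕ_)
open import Data.Integer.Divisibility using (_∣_)
open import Relation.Nullary using (¬_)

qstar : ℕ → ℤ
qstar q = ((- (+ 1)) ^ ((q ∸ 1) ℕ./ 2)) * (+ q)

-- u_q(j) = (3^j - q* (-1)^j) / 4   (exact division for odd prime q, since q* ≡ 1 mod 4)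
u : ℕ → ℕ → ℤ
u q j = ((+ 3) ^ j - qstar q * ((- (+ 1)) ^ j)) /ℕ 4

_≡_[mod_] : ℤ → ℤ → ℕ → Set
a ≡ b [mod m ] = (+ m) ∣ (a - b)

PairwiseIncongruent : ℕ → ℕ → ℕ → Set
PairwiseIncongruent q n m =
  ∀ i j → 1 ≤ i → i < j → j ≤ n → ¬ (u q i ≡ u q j [mod m ])

IsD : ℕ → ℕ → ℕ → Set
IsD q n m = 1 ≤ m × PairwiseIncongruent q n m
          × (∀ m′ → 1 ≤ m′ → m′ < m → ¬ PairwiseIncongruent q n m′)
  where open import Data.Product using (_×_)

{-# OPTIONS --safe #-}
-- Since q is odd, q* ≡ 1 (mod 4), and 4 u(j) = 3^j − q*(−1)^j. For every k the difference
-- u(i + 2^k) − u(i) is 2^k times an odd number: for k = 0 because 3^i ≡ (−1)^i (mod 4), and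
-- for k ≥ 1 because (−1)^(2^k) = 1 and 3^(2^k) − 1 is 2^(k+2) times an odd number. A function
-- with this property is injective modulo 2^k on any 2^k consecutive arguments, so D(n) ≤ 2^k for
-- the power of two with n ≤ 2^k < 2n; the lower bound D(n) ≥ n is the pigeonhole principle.
module Submission where

open import Defs
open import Data.Nat.Base as ℕ using (ℕ; zero; suc)
import Data.Nat.Properties as ℕ
import Data.Nat.Divisibility as ℕ
import Data.Nat.DivMod as ℕ
open import Data.Nat.Primality using (Prime; prime⇒irreducible)
open import Data.Integer.Base using (ℤ; _%ℕ_)
open import Data.Integer.DivMod using (n%ℕd<d)
open import Data.Product using (Σ; ∃-syntax; _×_; _,_; proj₁; proj₂)
open import Data.Sum using (_⊎_; inj₁; inj₂)
open import Function using (_∘_)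
open import Relation.Binary.PropositionalEquality
open import Relation.Nullary using (¬_; Dec; yes; no; contradiction)
import Relation.Binary.Reasoning.Setoid

even-or-odd : ∀ n → ∃[ s ] (n ≡ s ℕ.* 2 ⊎ n ≡ suc (s ℕ.* 2))
even-or-odd zero = 0 , inj₁ refl
even-or-odd (suc n) with even-or-odd n
... | s , inj₁ refl = s , inj₂ refl
... | s , inj₂ refl = suc s , inj₁ refl

module _ where
  open import Data.Integer.Base using (+_; -_; _+_; _-_; _*_; _^_; _/ℕ_; ∣_∣)
  open import Data.Integer.Properties
    using (*-comm; *-cancelʳ-≡; pos-*; ^-distribˡ-+-*; ^-*-assoc; ^-zeroˡ; +-identityˡ; +-inverseʳ)
  open import Data.Integer.DivMod using (a≡a%ℕn+[a/ℕn]*n)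
  open import Data.Integer.Divisibility.Signed
    using (_∣_; divides; ∣ᵤ⇒∣; ∣⇒∣ᵤ; ∣-refl; ∣m∣n⇒∣m+n; ∣m∣n⇒∣m-n; ∣m+n∣n⇒∣m;
           ∣m⇒∣m*n; ∣n⇒∣m*n; ∣m⇒∣-m; *-cancelˡ-∣; module ∣-Reasoning)
  open import Data.Integer.Tactic.RingSolver using (solve-∀)

  Odd : ℤ → Set
  Odd x = ∃[ s ] x ≡ + 1 + + 2 * s

  odd-1 : Odd (+ 1)
  odd-1 = + 0 , refl

  odd-3 : Odd (+ 3)
  odd-3 = + 1 , refl

  odd-[-1] : Odd (- (+ 1))
  odd-[-1] = - (+ 1) , refl

  odd-* : ∀ {x y} → Odd x → Odd y → Odd (x * y)
  odd-* (s , refl) (t , refl) = s + t + + 2 * s * t , identity s t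
    where
    identity : ∀ s t → (+ 1 + + 2 * s) * (+ 1 + + 2 * t) ≡ + 1 + + 2 * (s + t + + 2 * s * t)
    identity = solve-∀

  odd-+-even : ∀ {x} → Odd x → ∀ y → Odd (x + + 2 * y)
  odd-+-even (s , refl) y = s + y , identity s y
    where
    identity : ∀ s y → + 1 + + 2 * s + + 2 * y ≡ + 1 + + 2 * (s + y)
    identity = solve-∀

  odd-^ : ∀ {x} → Odd x → ∀ n → Odd (x ^ n)
  odd-^ _     zero    = odd-1
  odd-^ x-odd (suc n) = odd-* x-odd (odd-^ x-odd n)

  odd⇒2∤ : ∀ {x} → Odd x → ¬ (+ 2 ∣ x)
  odd⇒2∤ (s , refl) 2∣x = 2∤1 (∣⇒∣ᵤ (∣m+n∣n⇒∣m {m = + 1} 2∣x (∣m⇒∣m*n s ∣-refl)))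
    where
    2∤1 : ¬ (2 ℕ.∣ 1)
    2∤1 2∣1 = contradiction (ℕ.∣1⇒≡1 2∣1) λ ()

  pos-^ : ∀ m n → + (m ℕ.^ n) ≡ (+ m) ^ n
  pos-^ m zero    = refl
  pos-^ m (suc n) = trans (pos-* m (m ℕ.^ n)) (cong ((+ m) *_) (pos-^ m n))

  [-1]^even : ∀ r → (- (+ 1)) ^ (r ℕ.* 2) ≡ + 1
  [-1]^even r = begin
    (- (+ 1)) ^ (r ℕ.* 2) ≡⟨ cong ((- (+ 1)) ^_) (ℕ.*-comm r 2) ⟩
    (- (+ 1)) ^ (2 ℕ.* r) ≡⟨ ^-*-assoc (- (+ 1)) 2 r ⟨
    (+ 1) ^ r             ≡⟨ ^-zeroˡ r ⟩
    + 1                   ∎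
    where open ≡-Reasoning

  ^-cong-∣ : ∀ {k a b} → k ∣ a - b → ∀ n → k ∣ a ^ n - b ^ n
  ^-cong-∣ _     zero    = divides (+ 0) refl
  ^-cong-∣ {k} {a} {b} k∣a-b (suc n) = begin
    k                                     ∣⟨ ∣m∣n⇒∣m+n (∣n⇒∣m*n a (^-cong-∣ k∣a-b n)) (∣m⇒∣m*n (b ^ n) k∣a-b) ⟩
    a * (a ^ n - b ^ n) + (a - b) * b ^ n ≡⟨ identity a b (a ^ n) (b ^ n) ⟩
    a * a ^ n - b * b ^ n                 ∎
    where
    open ∣-Reasoning
    identity : ∀ a b x y → a * (x - y) + (a - b) * y ≡ a * x - b * y
    identity = solve-∀

  /ℕ-exact : ∀ {n} d .{{_ : ℕ.NonZero d}} → + d ∣ n → n /ℕ d * + d ≡ n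
  /ℕ-exact {n} d d∣n =
    sym (trans (a≡a%ℕn+[a/ℕn]*n n d) (trans (cong (λ r → + r + n /ℕ d * + d) remainder≡0) (+-identityˡ _)))
    where
    d∣remainder : d ℕ.∣ n %ℕ d
    d∣remainder = ∣⇒∣ᵤ (begin
      + d                                      ∣⟨ ∣m∣n⇒∣m-n d∣n (∣n⇒∣m*n (n /ℕ d) ∣-refl) ⟩
      n - n /ℕ d * + d                         ≡⟨ cong (_- n /ℕ d * + d) (a≡a%ℕn+[a/ℕn]*n n d) ⟩
      + (n %ℕ d) + n /ℕ d * + d - n /ℕ d * + d ≡⟨ cancel (+ (n %ℕ d)) (n /ℕ d * + d) ⟩
      + (n %ℕ d)                               ∎)
      where
      open ∣-Reasoning
      cancel : ∀ r x → r + x - x ≡ r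
      cancel = solve-∀
    remainder≡0 : n %ℕ d ≡ 0
    remainder≡0 = ∣∧<⇒≡0 d∣remainder (n%ℕd<d n d)
      where
      ∣∧<⇒≡0 : ∀ {d r} → d ℕ.∣ r → r ℕ.< d → r ≡ 0
      ∣∧<⇒≡0 {r = zero}  _   _   = refl
      ∣∧<⇒≡0 {r = suc _} d∣r r<d = contradiction d∣r (ℕ.>⇒∤ r<d)

  ≡[mod]-refl : ∀ {a m} → a ≡ a [mod m ]
  ≡[mod]-refl {a} {m} = ∣⇒∣ᵤ {+ m} (divides (+ 0) (+-inverseʳ a))

  ≡[mod]-sym : ∀ {a b m} → a ≡ b [mod m ] → b ≡ a [mod m ]
  ≡[mod]-sym {a} {b} {m} a≡b = ∣⇒∣ᵤ (begin
    + m       ∣⟨ ∣m⇒∣-m (∣ᵤ⇒∣ {i = a - b} a≡b) ⟩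
    - (a - b) ≡⟨ identity a b ⟩
    b - a     ∎)
    where
    open ∣-Reasoning
    identity : ∀ a b → - (a - b) ≡ b - a
    identity = solve-∀

  ≡[mod]-trans : ∀ {a b c m} → a ≡ b [mod m ] → b ≡ c [mod m ] → a ≡ c [mod m ]
  ≡[mod]-trans {a} {b} {c} {m} a≡b b≡c = ∣⇒∣ᵤ (begin
    + m               ∣⟨ ∣m∣n⇒∣m+n (∣ᵤ⇒∣ {i = a - b} a≡b) (∣ᵤ⇒∣ {i = b - c} b≡c) ⟩
    (a - b) + (b - c) ≡⟨ identity a b c ⟩
    a - c             ∎)
    where
    open ∣-Reasoning
    identity : ∀ a b c → (a - b) + (b - c) ≡ a - c
    identity = solve-∀

  ≡[mod]-weaken : ∀ {a b m n} → m ℕ.∣ n → a ≡ b [mod n ] → a ≡ b [mod m ]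
  ≡[mod]-weaken = ℕ.∣-trans

  _≡?_[mod_] : ∀ a b m → Dec (a ≡ b [mod m ])
  a ≡? b [mod m ] = m ℕ.∣? ∣ a - b ∣

  %ℕ-cong⇒≡[mod] : ∀ {a b} m .{{_ : ℕ.NonZero m}} → a %ℕ m ≡ b %ℕ m → a ≡ b [mod m ]
  %ℕ-cong⇒≡[mod] {a} {b} m a%m≡b%m = ∣⇒∣ᵤ (divides (a /ℕ m - b /ℕ m) (begin
    a - b
      ≡⟨ cong₂ _-_ (a≡a%ℕn+[a/ℕn]*n a m) (a≡a%ℕn+[a/ℕn]*n b m) ⟩
    + (a %ℕ m) + a /ℕ m * + m - (+ (b %ℕ m) + b /ℕ m * + m)
      ≡⟨ cong (λ r → + (a %ℕ m) + a /ℕ m * + m - (+ r + b /ℕ m * + m)) a%m≡b%m ⟨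
    + (a %ℕ m) + a /ℕ m * + m - (+ (a %ℕ m) + b /ℕ m * + m)
      ≡⟨ identity (+ (a %ℕ m)) (a /ℕ m) (b /ℕ m) (+ m) ⟩
    (a /ℕ m - b /ℕ m) * + m ∎))
    where
    open ≡-Reasoning
    identity : ∀ r x y m → r + x * m - (r + y * m) ≡ (x - y) * m
    identity = solve-∀

  odd-multiple⇒exact : ∀ {a b o} k → Odd o → a - b ≡ (+ 2) ^ k * o →
                       a ≡ b [mod 2 ℕ.^ k ] × ¬ (a ≡ b [mod 2 ℕ.^ suc k ])
  odd-multiple⇒exact {a} {b} {o} k o-odd eq = ∣⇒∣ᵤ (divides o a-b≡o*2^k) , 2^[1+k]∤a-b
    where
    instance _ = ℕ.m^n≢0 2 k
    a-b≡2^k*o : a - b ≡ + (2 ℕ.^ k) * o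
    a-b≡2^k*o = trans eq (cong (_* o) (sym (pos-^ 2 k)))
    a-b≡o*2^k : a - b ≡ o * + (2 ℕ.^ k)
    a-b≡o*2^k = trans a-b≡2^k*o (*-comm (+ (2 ℕ.^ k)) o)
    2^[1+k]∤a-b : ¬ (a ≡ b [mod 2 ℕ.^ suc k ])
    2^[1+k]∤a-b h = odd⇒2∤ o-odd (*-cancelˡ-∣ (+ (2 ℕ.^ k)) (begin
      + (2 ℕ.^ k) * + 2 ≡⟨ *-comm (+ (2 ℕ.^ k)) (+ 2) ⟩
      + 2 * + (2 ℕ.^ k) ≡⟨ pos-* 2 (2 ℕ.^ k) ⟨
      + (2 ℕ.^ suc k)   ∣⟨ ∣ᵤ⇒∣ {i = a - b} h ⟩
      a - b             ≡⟨ a-b≡2^k*o ⟩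
      + (2 ℕ.^ k) * o   ∎))
      where open ∣-Reasoning

  qstar-odd : ∀ s → qstar (suc (s ℕ.* 2)) ≡ (- (+ 1)) ^ s * (+ 1 + + s * + 2)
  qstar-odd s = cong₂ (λ e y → (- (+ 1)) ^ e * (+ 1 + y)) (ℕ.m*n/n≡m s 2) (pos-* s 2)

  qstar-odd≡1[mod4] : ∀ s → + 4 ∣ qstar (suc (s ℕ.* 2)) - + 1
  qstar-odd≡1[mod4] s with even-or-odd s
  ... | r , inj₁ refl = divides (+ r) (begin
    qstar (suc (r ℕ.* 2 ℕ.* 2)) - + 1
      ≡⟨ cong (_- + 1) (qstar-odd (r ℕ.* 2)) ⟩
    (- (+ 1)) ^ (r ℕ.* 2) * (+ 1 + + (r ℕ.* 2) * + 2) - + 1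
      ≡⟨ cong₂ (λ x y → x * (+ 1 + y * + 2) - + 1) ([-1]^even r) (pos-* r 2) ⟩
    + 1 * (+ 1 + + r * + 2 * + 2) - + 1
      ≡⟨ identity (+ r) ⟩
    + r * + 4 ∎)
    where
    open ≡-Reasoning
    identity : ∀ r → + 1 * (+ 1 + r * + 2 * + 2) - + 1 ≡ r * + 4
    identity = solve-∀
  ... | r , inj₂ refl = divides (- (+ 1 + + r)) (begin
    qstar (suc (suc (r ℕ.* 2) ℕ.* 2)) - + 1
      ≡⟨ cong (_- + 1) (qstar-odd (suc (r ℕ.* 2))) ⟩
    (- (+ 1)) ^ suc (r ℕ.* 2) * (+ 1 + + suc (r ℕ.* 2) * + 2) - + 1
      ≡⟨ cong₂ (λ x y → - (+ 1) * x * (+ 1 + (+ 1 + y) * + 2) - + 1) ([-1]^even r) (pos-* r 2) ⟩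
    - (+ 1) * + 1 * (+ 1 + (+ 1 + + r * + 2) * + 2) - + 1
      ≡⟨ identity (+ r) ⟩
    - (+ 1 + + r) * + 4 ∎)
    where
    open ≡-Reasoning
    identity : ∀ r → - (+ 1) * + 1 * (+ 1 + (+ 1 + r * + 2) * + 2) - + 1 ≡ - (+ 1 + r) * + 4
    identity = solve-∀

  qstar≡1[mod4] : ∀ {q} → Prime q → q ≢ 2 → + 4 ∣ qstar q - + 1
  qstar≡1[mod4] {q} q-prime q≢2 with even-or-odd q
  ... | s , inj₂ refl = qstar-odd≡1[mod4] s
  ... | s , inj₁ refl with prime⇒irreducible q-prime (ℕ.n∣m*n s)
  ...   | inj₁ ()
  ...   | inj₂ 2≡q = contradiction (sym 2≡q) q≢2

  numerator : ℤ → ℕ → ℤ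
  numerator c j = (+ 3) ^ j - c * (- (+ 1)) ^ j

  4∣numerator : ∀ {c} → + 4 ∣ c - + 1 → ∀ j → + 4 ∣ numerator c j
  4∣numerator {c} 4∣c-1 j = begin
    + 4
      ∣⟨ ∣m∣n⇒∣m-n (^-cong-∣ {a = + 3} {b = - (+ 1)} ∣-refl j) (∣m⇒∣m*n ((- (+ 1)) ^ j) 4∣c-1) ⟩
    ((+ 3) ^ j - (- (+ 1)) ^ j) - (c - + 1) * (- (+ 1)) ^ j
      ≡⟨ identity c ((+ 3) ^ j) ((- (+ 1)) ^ j) ⟩
    numerator c j ∎
    where
    open ∣-Reasoning
    identity : ∀ c P S → (P - S) - (c - + 1) * S ≡ P - c * S
    identity = solve-∀

  numerator-+ : ∀ c i m → numerator c (i ℕ.+ m) - numerator c i ≡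
                (+ 3) ^ i * ((+ 3) ^ m - + 1) - c * (- (+ 1)) ^ i * ((- (+ 1)) ^ m - + 1)
  numerator-+ c i m = begin
    numerator c (i ℕ.+ m) - numerator c i
      ≡⟨ cong₂ (λ x y → x - c * y - numerator c i) (^-distribˡ-+-* (+ 3) i m) (^-distribˡ-+-* (- (+ 1)) i m) ⟩
    (+ 3) ^ i * (+ 3) ^ m - c * ((- (+ 1)) ^ i * (- (+ 1)) ^ m) - numerator c i
      ≡⟨ identity c ((+ 3) ^ i) ((+ 3) ^ m) ((- (+ 1)) ^ i) ((- (+ 1)) ^ m) ⟩
    (+ 3) ^ i * ((+ 3) ^ m - + 1) - c * (- (+ 1)) ^ i * ((- (+ 1)) ^ m - + 1) ∎
    where
    open ≡-Reasoning
    identity : ∀ c P Q S T → P * Q - c * (S * T) - (P - c * S) ≡ P * (Q - + 1) - c * S * (T - + 1)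
    identity = solve-∀

  3^2^[1+k]-1 : ∀ k → ∃[ o ] Odd o × (+ 3) ^ (2 ℕ.^ suc k) - + 1 ≡ (+ 2) ^ (3 ℕ.+ k) * o
  3^2^[1+k]-1 zero = + 1 , odd-1 , refl
  3^2^[1+k]-1 (suc k) with 3^2^[1+k]-1 k
  ... | o , o-odd , eq = o′ , odd-* o-odd (odd-+-even odd-1 ((+ 2) ^ suc k * o)) , (begin
    (+ 3) ^ (2 ℕ.* M) - + 1
      ≡⟨ cong (λ e → (+ 3) ^ e - + 1) (ℕ.*-comm 2 M) ⟩
    (+ 3) ^ (M ℕ.* 2) - + 1
      ≡⟨ cong (_- + 1) (^-*-assoc (+ 3) M 2) ⟨
    ((+ 3) ^ M) ^ 2 - + 1
      ≡⟨ difference-of-squares ((+ 3) ^ M) ⟩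
    ((+ 3) ^ M - + 1) * ((+ 3) ^ M - + 1 + + 2)
      ≡⟨ cong (λ x → x * (x + + 2)) eq ⟩
    (+ 2) ^ (3 ℕ.+ k) * o * ((+ 2) ^ (3 ℕ.+ k) * o + + 2)
      ≡⟨ identity ((+ 2) ^ k) o ⟩
    (+ 2) ^ (3 ℕ.+ suc k) * o′ ∎)
    where
    M = 2 ℕ.^ suc k
    o′ = o * (+ 1 + + 2 * ((+ 2) ^ suc k * o))
    open ≡-Reasoning
    difference-of-squares : ∀ x → x * (x * + 1) - + 1 ≡ (x - + 1) * (x - + 1 + + 2)
    difference-of-squares = solve-∀
    identity : ∀ T o → + 2 * (+ 2 * (+ 2 * T)) * o * (+ 2 * (+ 2 * (+ 2 * T)) * o + + 2)
                     ≡ + 2 * (+ 2 * (+ 2 * (+ 2 * T))) * (o * (+ 1 + + 2 * (+ 2 * T * o)))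
    identity = solve-∀

  numerator-step : ∀ {c} → + 4 ∣ c - + 1 → ∀ k i →
                   ∃[ o ] Odd o × numerator c (i ℕ.+ 2 ℕ.^ k) - numerator c i ≡ (+ 2) ^ k * o * + 4
  numerator-step {c} (divides e c-1≡e*4) zero i with ^-cong-∣ {a = + 3} {b = - (+ 1)} ∣-refl i
  ... | divides w 3^i-[-1]^i≡w*4 = S + + 2 * (w + e * S) , odd-+-even (odd-^ odd-[-1] i) _ , (begin
    numerator c (i ℕ.+ 1) - numerator c i
      ≡⟨ numerator-+ c i 1 ⟩
    P * (+ 3 * + 1 - + 1) - c * S * (- (+ 1) * + 1 - + 1)
      ≡⟨ identity₁ c P S ⟩
    + 2 * (P - S) + + 2 * S * (c - + 1) + + 4 * S
      ≡⟨ cong₂ (λ x y → + 2 * x + + 2 * S * y + + 4 * S) 3^i-[-1]^i≡w*4 c-1≡e*4 ⟩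
    + 2 * (w * + 4) + + 2 * S * (e * + 4) + + 4 * S
      ≡⟨ identity₂ w e S ⟩
    + 1 * (S + + 2 * (w + e * S)) * + 4 ∎)
    where
    P = (+ 3) ^ i
    S = (- (+ 1)) ^ i
    open ≡-Reasoning
    identity₁ : ∀ c P S → P * (+ 3 * + 1 - + 1) - c * S * (- (+ 1) * + 1 - + 1)
                        ≡ + 2 * (P - S) + + 2 * S * (c - + 1) + + 4 * S
    identity₁ = solve-∀
    identity₂ : ∀ w e S → + 2 * (w * + 4) + + 2 * S * (e * + 4) + + 4 * S
                        ≡ + 1 * (S + + 2 * (w + e * S)) * + 4
    identity₂ = solve-∀
  numerator-step {c} _ (suc k) i with 3^2^[1+k]-1 k
  ... | o , o-odd , eq = (+ 3) ^ i * o , odd-* (odd-^ odd-3 i) o-odd , (begin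
    numerator c (i ℕ.+ M) - numerator c i                ≡⟨ numerator-+ c i M ⟩
    P * ((+ 3) ^ M - + 1) - c * S * ((- (+ 1)) ^ M - + 1) ≡⟨ cong₂ (λ x y → P * x - c * S * (y - + 1)) eq [-1]^M≡1 ⟩
    P * ((+ 2) ^ (3 ℕ.+ k) * o) - c * S * (+ 1 - + 1)     ≡⟨ identity c P S ((+ 2) ^ k) o ⟩
    (+ 2) ^ suc k * (P * o) * + 4                         ∎)
    where
    M = 2 ℕ.^ suc k
    P = (+ 3) ^ i
    S = (- (+ 1)) ^ i
    open ≡-Reasoning
    [-1]^M≡1 : (- (+ 1)) ^ M ≡ + 1
    [-1]^M≡1 = trans (cong ((- (+ 1)) ^_) (ℕ.*-comm 2 (2 ℕ.^ k))) ([-1]^even (2 ℕ.^ k))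
    identity : ∀ c P S T o → P * (+ 2 * (+ 2 * (+ 2 * T)) * o) - c * S * (+ 1 - + 1)
                           ≡ + 2 * T * (P * o) * + 4
    identity = solve-∀

  u-step : ∀ {q} → + 4 ∣ qstar q - + 1 → ∀ k i →
           ∃[ o ] Odd o × u q (i ℕ.+ 2 ℕ.^ k) - u q i ≡ (+ 2) ^ k * o
  u-step {q} 4∣q*-1 k i with numerator-step {qstar q} 4∣q*-1 k i
  ... | o , o-odd , eq = o , o-odd , *-cancelʳ-≡ _ _ (+ 4) (begin
    (u q j - u q i) * + 4                         ≡⟨ distrib (u q j) (u q i) ⟩
    u q j * + 4 - u q i * + 4                     ≡⟨ cong₂ _-_ (4u≡numerator j) (4u≡numerator i) ⟩
    numerator (qstar q) j - numerator (qstar q) i ≡⟨ eq ⟩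
    (+ 2) ^ k * o * + 4                           ∎)
    where
    j = i ℕ.+ 2 ℕ.^ k
    open ≡-Reasoning
    4u≡numerator : ∀ x → u q x * + 4 ≡ numerator (qstar q) x
    4u≡numerator x = /ℕ-exact 4 (4∣numerator {qstar q} 4∣q*-1 x)
    distrib : ∀ x y → (x - y) * + 4 ≡ x * + 4 - y * + 4
    distrib = solve-∀

open import Data.Nat.Base using (_+_; _*_; _^_; _∸_; _≤_; _<_; z≤n; s≤s)
open import Data.Nat.Tactic.RingSolver using (solve-∀)
open import Data.Fin.Base using (Fin; toℕ; fromℕ<)
import Data.Fin.Properties as Fin
open import Relation.Binary.Bundles using (Setoid)
open import Relation.Nullary.Decidable using (map′; _×-dec_; _→-dec_; ¬?)
open import Relation.Unary using (Decidable)

≡[mod]-setoid : ℕ → Setoid _ _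
≡[mod]-setoid m = record
  { Carrier       = ℤ
  ; _≈_           = λ a b → a ≡ b [mod m ]
  ; isEquivalence = record
    { refl  = λ {a} → ≡[mod]-refl {a}
    ; sym   = λ {a} {b} → ≡[mod]-sym {a} {b}
    ; trans = λ {a} {b} {c} → ≡[mod]-trans {a} {b} {c}
    }
  }

module ≡[mod]-Reasoning (m : ℕ) = Relation.Binary.Reasoning.Setoid (≡[mod]-setoid m)

periodic : ∀ {f : ℕ → ℤ} {p m} → (∀ j → f (j + p) ≡ f j [mod m ]) → ∀ s i → f (s * p + i) ≡ f i [mod m ]
periodic {f} step zero    i = ≡[mod]-refl {f i}
periodic {f} {p} {m} step (suc s) i = begin
  f (suc s * p + i) ≡⟨ cong f (shift p s i) ⟨
  f (s * p + i + p) ≈⟨ step (s * p + i) ⟩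
  f (s * p + i)     ≈⟨ periodic {f} {p} {m} step s i ⟩
  f i               ∎
  where
  open ≡[mod]-Reasoning m
  shift : ∀ p s i → s * p + i + p ≡ p + s * p + i
  shift = solve-∀

ExactDyadicSteps : (ℕ → ℤ) → Set
ExactDyadicSteps f = ∀ k i → f (i + 2 ^ k) ≡ f i [mod 2 ^ k ] × ¬ (f (i + 2 ^ k) ≡ f i [mod 2 ^ suc k ])

module _ {f : ℕ → ℤ} (exact : ExactDyadicSteps f) where

  ≡[mod2^k]⇒2^k∣ : ∀ k {i d} → f (i + d) ≡ f i [mod 2 ^ k ] → 2 ^ k ℕ.∣ d
  ≡[mod2^k]⇒2^k∣ zero    {d = d} _ = ℕ.1∣ d
  ≡[mod2^k]⇒2^k∣ (suc k) {i} {d} h with ≡[mod2^k]⇒2^k∣ k {i} {d} (≡[mod]-weaken {f (i + d)} {f i} (ℕ.n∣m*n 2) h)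
  ... | ℕ.divides t refl with even-or-odd t
  ...   | s , inj₁ refl = ℕ.divides s (ℕ.*-assoc s 2 (2 ^ k))
  ...   | s , inj₂ refl = contradiction step-is-a-period (proj₂ (exact k i))
    where
    -- d = 2^k + s 2^(k+1), and 2^(k+1) is a period of f modulo 2^(k+1).
    step-is-a-period : f (i + 2 ^ k) ≡ f i [mod 2 ^ suc k ]
    step-is-a-period = begin
      f (i + 2 ^ k)                   ≈⟨ periodic {f} (λ x → proj₁ (exact (suc k) x)) s (i + 2 ^ k) ⟨
      f (s * 2 ^ suc k + (i + 2 ^ k)) ≡⟨ cong f (regroup i s (2 ^ k)) ⟩
      f (i + suc (s * 2) * 2 ^ k)     ≈⟨ h ⟩
      f i                             ∎
      where
      open ≡[mod]-Reasoning (2 ^ suc k)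
      regroup : ∀ i s P → s * (2 * P) + (i + P) ≡ i + suc (s * 2) * P
      regroup = solve-∀

  ≢[mod2^k] : ∀ k {i d} → 0 < d → d < 2 ^ k → ¬ (f (i + d) ≡ f i [mod 2 ^ k ])
  ≢[mod2^k] k 0<d d<2^k h = ℕ.<⇒≱ d<2^k (ℕ.∣⇒≤ {{ℕ.>-nonZero 0<d}} (≡[mod2^k]⇒2^k∣ k h))

u-exact : ∀ {q} → Prime q → q ≢ 2 → ExactDyadicSteps (u q)
u-exact {q} q-prime q≢2 k i =
  let o , o-odd , eq = u-step {q} (qstar≡1[mod4] {q} q-prime q≢2) k i
  in  odd-multiple⇒exact {u q (i + 2 ^ k)} {u q i} {o} k o-odd eq

u-incongruent-mod-2^k : ∀ {q n k} → Prime q → q ≢ 2 → n ≤ 2 ^ k → PairwiseIncongruent q n (2 ^ k)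
u-incongruent-mod-2^k {q} {n} {k} q-prime q≢2 n≤2^k i j 1≤i i<j j≤n uᵢ≡uⱼ =
  ≢[mod2^k] {u q} (u-exact {q} q-prime q≢2) k {i} {j ∸ i} (ℕ.m<n⇒0<n∸m i<j) j∸i<2^k (begin
    u q (i + (j ∸ i)) ≡⟨ cong (u q) (ℕ.m+[n∸m]≡n (ℕ.<⇒≤ i<j)) ⟩
    u q j             ≈⟨ uᵢ≡uⱼ ⟨
    u q i             ∎)
  where
  open ≡[mod]-Reasoning (2 ^ k)
  j∸i<2^k : j ∸ i < 2 ^ k
  j∸i<2^k = ℕ.<-≤-trans (ℕ.∸-monoʳ-< 1≤i (ℕ.<⇒≤ i<j)) (ℕ.≤-trans j≤n n≤2^k)

incongruent⇒n≤m : ∀ {q n m} → 1 ≤ m → PairwiseIncongruent q n m → n ≤ m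
incongruent⇒n≤m {q} {n} {m} 1≤m incongruent = ℕ.≮⇒≥ λ m<n →
  let i , j , i<j , same-residue = Fin.pigeonhole m<n residue
  in  incongruent (suc (toℕ i)) (suc (toℕ j)) (s≤s z≤n) (s≤s i<j) (Fin.toℕ<n j)
        (%ℕ-cong⇒≡[mod] {u q (suc (toℕ i))} {u q (suc (toℕ j))} m
          (Fin.fromℕ<-injective _ _ _ _ same-residue))
  where
  instance _ = ℕ.>-nonZero 1≤m
  residue : Fin n → Fin m
  residue x = fromℕ< (n%ℕd<d (u q (suc (toℕ x))) m)

pairwiseIncongruent? : ∀ q n m → Dec (PairwiseIncongruent q n m)
pairwiseIncongruent? q n m =
  map′ (λ h i j 1≤i i<j j≤n → h (s≤s j≤n) i<j 1≤i j≤n)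
       (λ h {j} _ {i} i<j 1≤i j≤n → h i j 1≤i i<j j≤n)
       (ℕ.allUpTo? (λ j → ℕ.allUpTo? (λ i → incongruent? i j) j) (suc n))
  where
  incongruent? : ∀ i j → Dec (1 ≤ i → j ≤ n → ¬ (u q i ≡ u q j [mod m ]))
  incongruent? i j = (1 ℕ.≤? i) →-dec (j ℕ.≤? n) →-dec ¬? (u q i ≡? u q j [mod m ])

minimal-witness : ∀ {P : ℕ → Set} → Decidable P → ∀ b → ∃[ n ] n < b × P n →
                  ∃[ m ] m < b × P m × (∀ {n} → n < m → ¬ P n)
minimal-witness {P} P? (suc b) (n , n<1+b , Pn) with ℕ.anyUpTo? P? b
... | yes below =
  let m , m<b , Pm , minimal = minimal-witness P? b below
  in  m , ℕ.m<n⇒m<1+n m<b , Pm , minimal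
... | no ¬below = b , ℕ.≤-refl , Pb , λ n<b Pn → ¬below (_ , n<b , Pn)
  where
  Pb : P b
  Pb with ℕ.m<1+n⇒m<n∨m≡n n<1+b
  ... | inj₁ n<b  = contradiction (n , n<b , Pn) ¬below
  ... | inj₂ refl = Pn

n≤2^k<2n : ∀ n → 1 ≤ n → ∃[ k ] n ≤ 2 ^ k × 2 ^ k < 2 * n
n≤2^k<2n (suc zero)    _ = 0 , ℕ.≤-refl , s≤s (s≤s z≤n)
n≤2^k<2n (suc (suc n)) _ with n≤2^k<2n (suc n) (s≤s z≤n)
... | k , 1+n≤2^k , 2^k<2[1+n] with suc (suc n) ℕ.≤? 2 ^ k
...   | yes 2+n≤2^k = k , 2+n≤2^k , ℕ.<-≤-trans 2^k<2[1+n] (ℕ.*-monoʳ-≤ 2 (ℕ.n≤1+n (suc n)))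
...   | no  2+n≰2^k = suc k , subst (λ x → 2 + n ≤ 2 * x × 2 * x < 2 * (2 + n)) (sym 2^k≡1+n)
                                (2+n≤2[1+n] , ℕ.*-monoʳ-< 2 (ℕ.n<1+n (suc n)))
  where
  2^k≡1+n : 2 ^ k ≡ suc n
  2^k≡1+n = ℕ.≤-antisym (ℕ.m<1+n⇒m≤n (ℕ.≰⇒> 2+n≰2^k)) 1+n≤2^k
  identity : ∀ n → 2 + n + n ≡ 2 * (1 + n)
  identity = solve-∀
  2+n≤2[1+n] : 2 + n ≤ 2 * (1 + n)
  2+n≤2[1+n] = subst (2 + n ≤_) (identity n) (ℕ.m≤m+n (2 + n) n)

corollary1 : (q : ℕ) → Prime q → 5 ≤ q → (n : ℕ) → 1 ≤ n →
    Σ ℕ (λ m → IsD q n m × n ≤ m × m ≤ 2 * n ∸ 1)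
corollary1 q q-prime 5≤q n 1≤n =
  let k , n≤2^k , 2^k<2n                          = n≤2^k<2n n 1≤n
      m , m<1+2^k , (1≤m , incongruent) , minimal = minimal-witness D? (suc (2 ^ k))
        (2 ^ k , ℕ.≤-refl , ℕ.m^n>0 2 k , u-incongruent-mod-2^k {q} {n} {k} q-prime q≢2 n≤2^k)
  in  m , (1≤m , incongruent , λ m′ 1≤m′ m′<m → minimal m′<m ∘ (1≤m′ ,_))
        , incongruent⇒n≤m {q} {n} {m} 1≤m incongruent
        , m<n⇒m≤n∸1 (ℕ.≤-<-trans (ℕ.m<1+n⇒m≤n m<1+2^k) 2^k<2n)
  where
  q≢2 : q ≢ 2
  q≢2 = ℕ.>⇒≢ (ℕ.≤-trans (ℕ.m≤m+n 3 2) 5≤q)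
  D? : Decidable (λ m → 1 ≤ m × PairwiseIncongruent q n m)
  D? m = (1 ℕ.≤? m) ×-dec pairwiseIncongruent? q n m
  m<n⇒m≤n∸1 : ∀ {m n} → m < n → m ≤ n ∸ 1
  m<n⇒m≤n∸1 (s≤s m≤n) = m≤n
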